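{- Let $\mathfrak{B}$ be a Boolean weak contact algebra. (i) Every abstractive set $A$ satisfies: for every $x\in A$ there is $y\in A$ with $y\ll x$ and $y\neq x$. (ii) If $X$ is a set of regions such that $X\trianglelefteq Q$ for some G-representative $Q$, then $X$ satisfies condition (r3): for all regions $x,y$, if $u\mathrel{\mathsf{O}} x$ and $u\mathrel{\mathsf{O}} y$ for every $u\in X$, then $x\mathrel{\mathsf{C}} y$. (iii) If $A$ is an abstractive set, $Q$ is a G-representative and $A\trianglelefteq Q$, then $A$ is a G-representative and $A$ and $Q$ are coinitial (i.e., $A\trianglelefteq Q$ and $Q\trianglelefteq A$).
   Context: A Boolean weak contact algebra is a Boolean algebra $\langle B,\cdot,+,-,\mathsf{0},\mathsf{1}\rangle$ with a relation $\mathsf{C}$ satisfying (C0) $\neg(\mathsf{0}\mathrel{\mathsf{C}} x)$; (C1) $x\leq y\wedge x\neq\mathsf{0}\to x\mathrel{\mathsf{C}} y$; (C2) symmetry; (C3) $x\leq y\to\forall z(z\mathrel{\mathsf{C}} x\to z\mathrel{\mathsf{C}} y)$. $x\ll y$ iff $\neg(x\mathrel{\mathsf{C}} -y)$; $x\mathrel{\mathsf{O}} y$ iff $x\cdot y\neq\mathsf{0}$. For $X,Y\subseteq B$, $X\trianglelefteq Y$ means: for every $y\in Y$ there is $x\in X$ with $x\leq y$. A G-representative is a non-empty $Q\subseteq B$ with (r0) $\mathsf{0}\notin Q$; (r1) for all $u,v\in Q$: $u=v$ or $u\ll v$ or $v\ll u$; (r2) for every $u\in Q$ there is $v\in Q$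 with $v\ll u$; (r3) for all $x,y$: if $u\mathrel{\mathsf{O}} x$ and $u\mathrel{\mathsf{O}} y$ for all $u\in Q$ then $x\mathrel{\mathsf{C}} y$. An abstractive set is $A\subseteq B$ with (r0), (r1) and (A): there is no non-zero $x\in B$ with $x\leq y$ for all $y\in A$. -}

module Defs where

open import Level using (Level; _⊔_) renaming (suc to lsuc)
open import Algebra.Lattice.Bundles using (BooleanAlgebra)
open import Data.Product using (Σ; _×_; _,_)
open import Data.Sum using (_⊎_)
open import Relation.Nullary using (¬_)
open import Relation.Binary using (Rel)

-- A Boolean weak contact algebra: a Boolean algebra (with setoid equality ≈)
-- together with a contact relation C satisfying (C0)–(C3).
-- (C-resp) says C respects the algebra's equality (automatic when ≈ is ≡).
record BWCA (c ℓ r : Level) : Set (lsuc (c ⊔ ℓ ⊔ r)) where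
  field
    BA : BooleanAlgebra c ℓ
  open BooleanAlgebra BA public renaming (¬_ to -_; ⊥ to 𝟎; ⊤ to 𝟏)
  _≤_ : Carrier → Carrier → Set ℓ
  x ≤ y = (x ∧ y) ≈ x
  field
    C      : Rel Carrier r
    C-resp : ∀ {x x' y y'} → x ≈ x' → y ≈ y' → C x y → C x' y'
    C0     : ∀ x → ¬ C 𝟎 x
    C1     : ∀ x y → x ≤ y → ¬ (x ≈ 𝟎) → C x y
    C2     : ∀ x y → C x y → C y x
    C3     : ∀ x y → x ≤ y → ∀ z → C z x → C z y

module _ {c ℓ r : Level} (𝔅 : BWCA c ℓ r) where
  open BWCA 𝔅

  _≪_ : Carrier → Carrier → Set r
  x ≪ y = ¬ C x (- y)

  O : Carrier → Carrier → Set ℓ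
  O x y = ¬ ((x ∧ y) ≈ 𝟎)

  Subset : ∀ p → Set (c ⊔ lsuc p)
  Subset p = Carrier → Set p

  _⊴_ : ∀ {p q} → Subset p → Subset q → Set (c ⊔ ℓ ⊔ p ⊔ q)
  X ⊴ Y = ∀ y → Y y → Σ Carrier λ x → X x × x ≤ y

  r0 : ∀ {p} → Subset p → Set (c ⊔ ℓ ⊔ p)
  r0 Q = ∀ u → Q u → ¬ (u ≈ 𝟎)

  r1 : ∀ {p} → Subset p → Set (c ⊔ ℓ ⊔ r ⊔ p)
  r1 Q = ∀ u v → Q u → Q v → (u ≈ v) ⊎ ((u ≪ v) ⊎ (v ≪ u))

  r2 : ∀ {p} → Subset p → Set (c ⊔ r ⊔ p)
  r2 Q = ∀ u → Q u → Σ Carrier λ v → Q v × v ≪ u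

  r3 : ∀ {p} → Subset p → Set (c ⊔ ℓ ⊔ r ⊔ p)
  r3 Q = ∀ x y → (∀ u → Q u → O u x × O u y) → C x y

  NonEmpty : ∀ {p} → Subset p → Set (c ⊔ p)
  NonEmpty Q = Σ Carrier Q

  IsGRepresentative : ∀ {p} → Subset p → Set (c ⊔ ℓ ⊔ r ⊔ p)
  IsGRepresentative Q = NonEmpty Q × r0 Q × r1 Q × r2 Q × r3 Q

  condA : ∀ {p} → Subset p → Set (c ⊔ ℓ ⊔ p)
  condA A = ¬ (Σ Carrier λ x → ¬ (x ≈ 𝟎) × (∀ y → A y → x ≤ y))

  IsAbstractive : ∀ {p} → Subset p → Set (c ⊔ ℓ ⊔ r ⊔ p)
  IsAbstractive A = r0 A × r1 A × condA A

  Coinitial : ∀ {p q} → Subset p → Subset q → Set (c ⊔ ℓ ⊔ p ⊔ q)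
  Coinitial X Y = (X ⊴ Y) × (Y ⊴ X)

-- x ≪ y implies x ≤ y, since otherwise x ∧ -y would be a nonzero overlap
-- and hence a contact of x with -y.  So an abstractive set A is a chain of
-- nonzero regions, any two of which overlap, and (A) yields for each x ∈ A
-- some y ∈ A with x ≰ y; comparability then forces y ≪ x.  Condition (r3)
-- passes to any X ⊴ Q, as a region overlapped by a smaller one is overlapped
-- by the larger.  If A ⊴ Q and some a ∈ A bounded no q ∈ Q, take a' ≪ a in
-- A: every q ∈ Q overlaps -a, and overlaps a' because it lies above a member
-- of the chain A, so (r3) for Q gives a' C -a, contradicting a' ≪ a.
module Submission where

open import Defs
open import Level using (Level)
open import Axiom.ExcludedMiddle using (ExcludedMiddle)
open import Axiom.DoubleNegationElimination using (em⇒dne)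
open import Data.Product using (Σ; _×_; _,_)
open import Data.Sum using (_⊎_; inj₁; inj₂)
open import Relation.Nullary using (¬_; contradiction)
open import Relation.Binary.Bundles using (Poset)
open import Relation.Binary.Lattice.Structures using (IsMeetSemilattice)
import Algebra.Lattice.Properties.BooleanAlgebra as BooleanAlgebraProperties
import Relation.Binary.Reasoning.Setoid as SetoidReasoning

module Order {c ℓ r : Level} (𝔅 : BWCA c ℓ r) where
  open BWCA 𝔅
  open BooleanAlgebraProperties BA
    using (poset; ∧-isOrderTheoreticMeetSemilattice; ∧-zeroʳ; ∧-identityʳ; ∨-identityʳ)
  open SetoidReasoning setoid

  -- The library orders a meet-semilattice by x ≈ x ∧ y, the mirror image of ≤.
  private
    module ≤ᴸ = Poset poset
    module ∧ᴸ = IsMeetSemilattice ∧-isOrderTheoreticMeetSemilattice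

  ≈⇒≤ : ∀ {x y} → x ≈ y → x ≤ y
  ≈⇒≤ x≈y = sym (≤ᴸ.reflexive x≈y)

  ≤-refl : ∀ {x} → x ≤ x
  ≤-refl = ≈⇒≤ refl

  ≤-trans : ∀ {x y z} → x ≤ y → y ≤ z → x ≤ z
  ≤-trans x≤y y≤z = sym (≤ᴸ.trans (sym x≤y) (sym y≤z))

  x∧y≤x : ∀ x y → (x ∧ y) ≤ x
  x∧y≤x x y = sym (∧ᴸ.x∧y≤x x y)

  x∧y≤y : ∀ x y → (x ∧ y) ≤ y
  x∧y≤y x y = sym (∧ᴸ.x∧y≤y x y)

  x∧-y≈𝟎⇒x≤y : ∀ {x y} → (x ∧ - y) ≈ 𝟎 → x ≤ y
  x∧-y≈𝟎⇒x≤y {x} {y} x∧-y≈𝟎 = begin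
    x ∧ y                ≈⟨ ∨-identityʳ _ ⟨
    (x ∧ y) ∨ 𝟎          ≈⟨ ∨-congˡ x∧-y≈𝟎 ⟨
    (x ∧ y) ∨ (x ∧ - y)  ≈⟨ ∧-distribˡ-∨ x y (- y) ⟨
    x ∧ (y ∨ - y)        ≈⟨ ∧-congˡ (∨-complementʳ y) ⟩
    x ∧ 𝟏                ≈⟨ ∧-identityʳ x ⟩
    x                    ∎

  ≤𝟎⇒≈𝟎 : ∀ {x} → x ≤ 𝟎 → x ≈ 𝟎
  ≤𝟎⇒≈𝟎 {x} x≤𝟎 = trans (sym x≤𝟎) (∧-zeroʳ x)

  nonzero-lower-bound⇒O : ∀ {x y z} → ¬ (x ≈ 𝟎) → x ≤ y → x ≤ z → O 𝔅 y z
  nonzero-lower-bound⇒O {x} x≉𝟎 x≤y x≤z y∧z≈𝟎 =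
    x≉𝟎 (≤𝟎⇒≈𝟎 (≤-trans (sym (∧ᴸ.∧-greatest (sym x≤y) (sym x≤z))) (≈⇒≤ y∧z≈𝟎)))

  O-monoˡ : ∀ {x y z} → x ≤ y → O 𝔅 x z → O 𝔅 y z
  O-monoˡ {x} {y} {z} x≤y x∧z≉𝟎 =
    nonzero-lower-bound⇒O x∧z≉𝟎 (≤-trans (x∧y≤x x z) x≤y) (x∧y≤y x z)

  C-monoˡ : ∀ {x y z} → x ≤ y → C x z → C y z
  C-monoˡ {x} {y} {z} x≤y x-C-z = C2 z y (C3 x y x≤y z (C2 x z x-C-z))

  O⇒C : ∀ {x y} → O 𝔅 x y → C x y
  O⇒C {x} {y} x∧y≉𝟎 = C-monoˡ (x∧y≤x x y) (C1 (x ∧ y) y (x∧y≤y x y) x∧y≉𝟎)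

  ⊴-nonEmpty : ∀ {p q} {X : Subset 𝔅 p} {Y : Subset 𝔅 q} →
    _⊴_ 𝔅 X Y → NonEmpty 𝔅 Y → NonEmpty 𝔅 X
  ⊴-nonEmpty X⊴Y (y , Yy) with X⊴Y y Yy
  ... | x , Xx , _ = x , Xx

  ⊴-preserves-r3 : ∀ {p q} {X : Subset 𝔅 p} {Q : Subset 𝔅 q} →
    r3 𝔅 Q → _⊴_ 𝔅 X Q → r3 𝔅 X
  ⊴-preserves-r3 {Q = Q} r3Q X⊴Q x y X-overlaps = r3Q x y Q-overlaps
    where
    Q-overlaps : ∀ u → Q u → O 𝔅 u x × O 𝔅 u y
    Q-overlaps u Qu with X⊴Q u Qu
    ... | v , Xv , v≤u with X-overlaps v Xv
    ...   | v-O-x , v-O-y = O-monoˡ v≤u v-O-x , O-monoˡ v≤u v-O-y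

module Classical (em : ∀ {a} → ExcludedMiddle a) {c ℓ r : Level} (𝔅 : BWCA c ℓ r) where
  open BWCA 𝔅
  open Order 𝔅

  private
    dne : ∀ {a} {P : Set a} → ¬ ¬ P → P
    dne = em⇒dne em

  ≪⇒≤ : ∀ {x y} → _≪_ 𝔅 x y → x ≤ y
  ≪⇒≤ x≪y = x∧-y≈𝟎⇒x≤y (dne (λ x-O--y → x≪y (O⇒C x-O--y)))

  r1⇒≤-total : ∀ {p} {A : Subset 𝔅 p} → r1 𝔅 A →
    ∀ {u v} → A u → A v → u ≤ v ⊎ v ≤ u
  r1⇒≤-total r1A {u} {v} Au Av with r1A u v Au Av
  ... | inj₁ u≈v        = inj₁ (≈⇒≤ u≈v)
  ... | inj₂ (inj₁ u≪v) = inj₁ (≪⇒≤ u≪v)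
  ... | inj₂ (inj₂ v≪u) = inj₂ (≪⇒≤ v≪u)

  r0∧r1⇒O : ∀ {p} {A : Subset 𝔅 p} → r0 𝔅 A → r1 𝔅 A →
    ∀ {u v} → A u → A v → O 𝔅 u v
  r0∧r1⇒O r0A r1A {u} {v} Au Av with r1⇒≤-total r1A Au Av
  ... | inj₁ u≤v = nonzero-lower-bound⇒O (r0A u Au) ≤-refl u≤v
  ... | inj₂ v≤u = nonzero-lower-bound⇒O (r0A v Av) v≤u ≤-refl

  abstractive⇒∃≰ : ∀ {p} {A : Subset 𝔅 p} → IsAbstractive 𝔅 A →
    ∀ {x} → A x → Σ Carrier λ y → A y × ¬ (x ≤ y)
  abstractive⇒∃≰ (r0A , _ , condA) {x} Ax =
    dne λ none → condA (x , r0A x Ax , λ y Ay → dne λ x≰y → none (y , Ay , x≰y))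

  abstractive⇒∃≪≉ : ∀ {p} (A : Subset 𝔅 p) → IsAbstractive 𝔅 A →
    ∀ x → A x → Σ Carrier λ y → A y × _≪_ 𝔅 y x × ¬ (y ≈ x)
  abstractive⇒∃≪≉ A abstractiveA@(_ , r1A , _) x Ax
    with abstractive⇒∃≰ abstractiveA Ax
  ... | y , Ay , x≰y with r1A x y Ax Ay
  ...   | inj₁ x≈y        = contradiction (≈⇒≤ x≈y) x≰y
  ...   | inj₂ (inj₁ x≪y) = contradiction (≪⇒≤ x≪y) x≰y
  ...   | inj₂ (inj₂ y≪x) = y , Ay , y≪x , λ y≈x → x≰y (≈⇒≤ (sym y≈x))

  abstractive⇒r2 : ∀ {p} {A : Subset 𝔅 p} → IsAbstractive 𝔅 A → r2 𝔅 A
  abstractive⇒r2 {A = A} abstractiveA u Au with abstractive⇒∃≪≉ A abstractiveA u Au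
  ... | v , Av , v≪u , _ = v , Av , v≪u

  abstractive-⊴⇒⊵ : ∀ {p q} {A : Subset 𝔅 p} {Q : Subset 𝔅 q} →
    IsAbstractive 𝔅 A → r3 𝔅 Q → _⊴_ 𝔅 A Q → _⊴_ 𝔅 Q A
  abstractive-⊴⇒⊵ {A = A} {Q} abstractiveA@(r0A , r1A , _) r3Q A⊴Q a Aa
    with abstractive⇒∃≪≉ A abstractiveA a Aa
  ... | a′ , Aa′ , a′≪a , _ = dne λ no-q≤a →
    a′≪a (r3Q a′ (- a) λ q Qq →
      overlaps-a′ q Qq , λ q∧-a≈𝟎 → no-q≤a (q , Qq , x∧-y≈𝟎⇒x≤y q∧-a≈𝟎))
    where
    overlaps-a′ : ∀ q → Q q → O 𝔅 q a′
    overlaps-a′ q Qq with A⊴Q q Qq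
    ... | b , Ab , b≤q = O-monoˡ b≤q (r0∧r1⇒O r0A r1A Ab Aa′)

proposition4p2 : (∀ {a} → ExcludedMiddle a) →
    ∀ {c ℓ r p} (𝔅 : BWCA c ℓ r) → let open BWCA 𝔅 in
    ((A : Subset 𝔅 p) → IsAbstractive 𝔅 A →
       ∀ x → A x → Σ Carrier λ y → A y × _≪_ 𝔅 y x × ¬ (y ≈ x))
    × ((X Q : Subset 𝔅 p) → IsGRepresentative 𝔅 Q → _⊴_ 𝔅 X Q → r3 𝔅 X)
    × ((A Q : Subset 𝔅 p) → IsAbstractive 𝔅 A → IsGRepresentative 𝔅 Q →
       _⊴_ 𝔅 A Q → IsGRepresentative 𝔅 A × Coinitial 𝔅 A Q)
proposition4p2 em 𝔅 =
    abstractive⇒∃≪≉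
  , (λ X Q (_ , _ , _ , _ , r3Q) X⊴Q → ⊴-preserves-r3 r3Q X⊴Q)
  , λ A Q abstractiveA@(r0A , r1A , _) (nonEmptyQ , _ , _ , _ , r3Q) A⊴Q →
      ( ⊴-nonEmpty A⊴Q nonEmptyQ , r0A , r1A
      , abstractive⇒r2 abstractiveA , ⊴-preserves-r3 r3Q A⊴Q )
    , A⊴Q , abstractive-⊴⇒⊵ abstractiveA r3Q A⊴Q
  where
  open Order 𝔅
  open Classical em 𝔅
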